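{- Let $\mathcal F$ be a class of general frames over a finite alphabet $\mathrm{Al}$ that is closed under countable disjoint sums. Then the modal depth of $\mathcal F$ equals the modal depth of its logic $\mathrm{Log}\,\mathcal F$.
   Context: A general frame is $F=(X,(R_\Diamond)_{\Diamond\in\mathrm{Al}},\mathcal A)$ with $\mathcal A$ a Boolean subalgebra of $\mathcal P(X)$ closed under $V\mapsto R_\Diamond^{ -1}[V]$; a valuation takes variables to $\mathcal A$; a formula is valid in $F$ if true at all points under all such valuations; $\mathrm{Log}\,\mathcal F$ is the set of formulas valid in all members of $\mathcal F$. The disjoint sum of general frames $F_i$ ($i\in I$) has domain the disjoint union, relations the unions, and admissible sets those $V$ with $V\cap X_i\in\mathcal A_i$ for all $i$. Modal depth of frames: for $\mathcal V\subseteq\mathcal P(X)$, $a\equiv_{\mathcal V}b$ iff $\forall V\in\mathcal V\,(a\in V\Leftrightarrow b\in V)$; $\sim_{\mathcal V,0}=\equiv_{\mathcal V}$, $\mathcal V_0=X/{\sim_{\mathcal V,0}}$; for $d\ge1$, $\sim_{\mathcal V,d}$ is the equivalence induced by $\mathcal V_{d-1}\cup\{R_\Diamond^{ -1}[V]:\Diamond\in\mathrm{Al},V\in\mathcal V_{d-1}\}$ and $\mathcal V_d=X/{\sim_{\mathcal V,d}}$; $\mathcal V_\omega=\bigcup_d\mathcal V_d$; $\mathrm{md}(V)=\min\{d:V\in\mathcal V_d\}$ for $V\in\mathcal V_\omega$; $\mathrm{md}(\mathcal V)=\sup_{V\in\mathcal V_\omega}\mathrm{md}(V)$; $\mathrm{md}(F)=\sup\{\mathrm{md}(\mathcal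 V):\mathcal V$ a finite subset of $\mathcal A\}$; $\mathrm{md}(\mathcal F)=\sup_{F\in\mathcal F}\mathrm{md}(F)$. Modal depth of logics: $\mathrm{md}(\varphi)$ is the maximal nesting of modalities, $\mathrm{md}_L(\varphi)=\min\{\mathrm{md}(\psi):\varphi\leftrightarrow\psi\in L\}$, $\mathrm{md}(L)=\sup_\varphi\mathrm{md}_L(\varphi)$. -}

module Defs where

open import Level using (Level; Lift) renaming (suc to lsuc; zero to lzero)
open import Data.Nat using (ℕ; zero; suc; _≤_; _⊔_)
open import Data.Fin using (Fin)
open import Data.Product using (Σ; ∃; _×_; _,_)
open import Data.Unit using (⊤)
open import Data.Empty using (⊥)
open import Data.List using (List)
open import Data.List.Relation.Unary.All using (All)
open import Relation.Nullary using (¬_)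
open import Relation.Binary.PropositionalEquality using (_≡_)
open import Function.Bundles using (_⇔_)
open import Function.Definitions using (Injective)

-- Frames over the finite alphabet Al = Fin k.
-- Subsets of X are predicates X → Set; the admissible family 𝒜 is a
-- predicate on subsets.

Subset : Set → Set₁
Subset X = X → Set

record Frame (k : ℕ) : Set₁ where
  field
    X : Set
    R : Fin k → X → X → Set
    A : Subset X → Set
open Frame public

Pre : ∀ {k} (F : Frame k) → Fin k → Subset (X F) → Subset (X F)
Pre F i V x = ∃ λ y → R F i x y × V y

record IsGeneral {k} (F : Frame k) : Set₁ where
  field
    resp  : ∀ {V W : Subset (X F)} → A F V → (∀ x → V x ⇔ W x) → A F W
    top   : A F (λ _ → ⊤)
    inter : ∀ {V W : Subset (X F)} → A F V → A F W → A F (λ x → V x × W x)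
    compl : ∀ {V : Subset (X F)} → A F V → A F (λ x → ¬ V x)
    pre   : ∀ (i : Fin k) {V : Subset (X F)} → A F V → A F (Pre F i V)

module _ {k : ℕ} {I : Set} (F : I → Frame k) where
  SumX : Set
  SumX = Σ I (λ i → X (F i))

  data SumR (j : Fin k) : SumX → SumX → Set where
    inj : ∀ {i x y} → R (F i) j x y → SumR j (i , x) (i , y)

  sumFrame : Frame k
  sumFrame = record
    { X = SumX
    ; R = SumR
    ; A = λ V → ∀ i → A (F i) (λ x → V (i , x))
    }

Countable : Set → Set
Countable I = Σ (I → ℕ) (Injective _≡_ _≡_)

ClosedUnderCountableSums : ∀ {k} → (Frame k → Set₁) → Set₁
ClosedUnderCountableSums {k} 𝓕 =
  (I : Set) → Countable I → (F : I → Frame k) →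
  (∀ i → 𝓕 (F i)) → 𝓕 (sumFrame F)

data Formula (k : ℕ) : Set where
  var  : ℕ → Formula k
  ⊥'   : Formula k
  _⇒_  : Formula k → Formula k → Formula k
  ◇    : Fin k → Formula k → Formula k

infixr 5 _⇒_

depth : ∀ {k} → Formula k → ℕ
depth (var _) = 0
depth ⊥' = 0
depth (φ ⇒ ψ) = depth φ ⊔ depth ψ
depth (◇ _ φ) = suc (depth φ)

¬' : ∀ {k} → Formula k → Formula k
¬' φ = φ ⇒ ⊥'

_∧'_ : ∀ {k} → Formula k → Formula k → Formula k
φ ∧' ψ = ¬' (φ ⇒ ¬' ψ)

_⟺_ : ∀ {k} → Formula k → Formula k → Formula k
φ ⟺ ψ = (φ ⇒ ψ) ∧' (ψ ⇒ φ)

Valuation : ∀ {k} → Frame k → Set₁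
Valuation F = ℕ → Subset (X F)

Sat : ∀ {k} (F : Frame k) → Valuation F → X F → Formula k → Set
Sat F v x (var p) = v p x
Sat F v x ⊥' = ⊥
Sat F v x (φ ⇒ ψ) = Sat F v x φ → Sat F v x ψ
Sat F v x (◇ i φ) = ∃ λ y → R F i x y × Sat F v y φ

Valid : ∀ {k} → Frame k → Formula k → Set₁
Valid F φ = (v : Valuation F) → (∀ p → A F (v p)) → ∀ x → Sat F v x φ

Log : ∀ {k} → (Frame k → Set₁) → Formula k → Set₁
Log 𝓕 φ = ∀ F → 𝓕 F → Valid F φ

MdLogic≤ : ∀ {k} → (Formula k → Set₁) → ℕ → Set₁
MdLogic≤ {k} L n = ∀ (φ : Formula k) → ∃ λ (ψ : Formula k) → depth ψ ≤ n × L (φ ⟺ ψ)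

IsClass : {Y : Set} → (Y → Y → Set₁) → Subset Y → Set₁
IsClass {Y} _~_ V = Σ Y λ a → ∀ b → V b ⇔ (a ~ b)

module _ {k : ℕ} (F : Frame k) (𝒱 : List (Subset (X F))) where
  sim : ℕ → X F → X F → Set₁
  sim zero a b = Lift (lsuc lzero) (All (λ V → V a ⇔ V b) 𝒱)
  sim (suc d) a b =
    (∀ (W : Subset (X F)) → IsClass (sim d) W → W a ⇔ W b) ×
    (∀ (i : Fin k) (W : Subset (X F)) → IsClass (sim d) W →
       Pre F i W a ⇔ Pre F i W b)

  InLayer : ℕ → Subset (X F) → Set₁
  InLayer d V = IsClass (sim d) V

  MdSet≤ : ℕ → Set₁
  MdSet≤ n = ∀ d V → InLayer d V → ∃ λ e → e ≤ n × InLayer e V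

MdFrame≤ : ∀ {k} → Frame k → ℕ → Set₁
MdFrame≤ F n = ∀ (𝒱 : List (Subset (X F))) → All (A F) 𝒱 → MdSet≤ F 𝒱 n

MdClass≤ : ∀ {k} → (Frame k → Set₁) → ℕ → Set₁
MdClass≤ {k} 𝓕 n = ∀ (F : Frame k) → 𝓕 F → MdFrame≤ F n

{-# OPTIONS --safe #-}
-- Read a finite family 𝒱 of admissible sets as the variables p₀ … pₘ₋₁. Over a finite
-- alphabet, a ∼_{𝒱,d} b holds exactly when a and b agree on the finite list basis d of
-- depth-d formulas, so every ∼_{𝒱,d}-class is defined by a characteristic formula (the
-- conjunction of basis literals true at one of its points), and md(𝒱) ≤ n means that ∼ₙ
-- refines every ∼_d.
--
-- If md(Log 𝓕) ≤ n, the characteristic formula of a ∼_d-class is Log 𝓕-equivalent to a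
-- formula of depth n; being ∼ₙ-invariant, it shows that ∼ₙ refines ∼_d.
--
-- If md(𝓕) ≤ n, a formula φ is equivalent to the disjunction of the depth-n
-- characteristic formulas realised together with φ at some point of a model over 𝓕: two
-- points with the same depth-n characteristic formula, placed side by side in the
-- disjoint sum of their frames (which lies in 𝓕), are ∼ₙ-related, hence ∼_{depth φ}-related,
-- hence agree on φ. Excluded middle decides which characteristic formulas are realised, so
-- sums of two frames already suffice.
module Submission where

open import Defs
open import Level using (Level; lift; 0ℓ) renaming (suc to lsuc)
open import Axiom.ExcludedMiddle using (ExcludedMiddle)
open import Axiom.DoubleNegationElimination using (em⇒dne)
open import Data.Bool using (Bool; true; false)
open import Data.Empty using (⊥; ⊥-elim)
open import Data.Fin using (Fin; zero; suc; toℕ)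
open import Data.Fin.Properties using (toℕ-injective)
open import Data.List
  using (List; []; _∷_; _++_; map; length; allFin; upTo; applyUpTo; filter; cartesianProductWith)
open import Data.List.Properties using (map-upTo)
open import Data.List.Membership.Propositional using (_∈_; find; lose)
open import Data.List.Membership.Propositional.Properties
  using ( ∈-map⁺; ∈-map⁻; ∈-++⁺ˡ; ∈-++⁺ʳ; ∈-++⁻; ∈-allFin; ∈-upTo⁺
        ; ∈-cartesianProductWith⁺; ∈-cartesianProductWith⁻; ∈-filter⁺; ∈-filter⁻)
open import Data.List.Relation.Unary.All as All using (All; []; _∷_)
open import Data.List.Relation.Unary.All.Properties using (++⁻ˡ; ++⁻ʳ; map⁺; map⁻)
open import Data.List.Relation.Unary.Any using (Any; here; there)
open import Data.Nat using (ℕ; zero; suc; _≤_; _<_; _⊔_; z≤n; s≤s; _≤′_; ≤′-refl; ≤′-step)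
open import Data.Nat.Properties
  using ( ≤-refl; ≤-total; ⊔-lub; m≤m⊔n; m≤n⊔m; m⊔n≤o⇒m≤o; m⊔n≤o⇒n≤o; m≤n⇒m≤1+n
        ; <-≤-trans; n<1+n; _<?_; ≮⇒≥; ≤⇒≤′)
open import Data.Product using (Σ; _×_; _,_; proj₁; proj₂)
open import Data.Sum using (inj₁; inj₂)
open import Data.Unit.Polymorphic using (⊤; tt)
open import Function using (_∘_)
open import Function.Bundles using (_⇔_; mk⇔; Equivalence)
import Function.Properties.Equivalence as ⇔
open import Relation.Nullary using (¬_; Dec; yes; no; does)
open import Relation.Nullary.Decidable using (True; toWitness; fromWitness)
open import Relation.Binary.PropositionalEquality using (_≡_; refl; cong; trans; subst)

open Equivalence using (to; from)

signs : ℕ → List (List Bool)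
signs zero    = [] ∷ []
signs (suc n) = map (true ∷_) (signs n) ++ map (false ∷_) (signs n)

∈-signs : {T : Set} (f : T → Bool) (xs : List T) → map f xs ∈ signs (length xs)
∈-signs f []       = here refl
∈-signs f (x ∷ xs) with f x
... | true  = ∈-++⁺ˡ (∈-map⁺ (true ∷_) (∈-signs f xs))
... | false = ∈-++⁺ʳ _ (∈-map⁺ (false ∷_) (∈-signs f xs))

module _ {k : ℕ} where

  ⊤' : Formula k
  ⊤' = ¬' ⊥'

  _∨'_ : Formula k → Formula k → Formula k
  θ ∨' η = ¬' θ ⇒ η

  literal : Bool → Formula k → Formula k
  literal true  θ = θ
  literal false θ = ¬' θ

  -- A sign list of the wrong length gives ⊥', so a satisfiable conj θs s
  -- fixes the truth value of every member of θs.
  conj : List (Formula k) → List Bool → Formula k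
  conj []       []      = ⊤'
  conj []       (_ ∷ _) = ⊥'
  conj (_ ∷ _)  []      = ⊥'
  conj (θ ∷ θs) (b ∷ s) = literal b θ ∧' conj θs s

  disj : List (Formula k) → Formula k
  disj []       = ⊥'
  disj (θ ∷ θs) = θ ∨' disj θs

  AllVars : ∀ {ℓ} → (ℕ → Set ℓ) → Formula k → Set ℓ
  AllVars P (var p) = P p
  AllVars P ⊥'      = ⊤
  AllVars P (θ ⇒ η) = AllVars P θ × AllVars P η
  AllVars P (◇ _ θ) = AllVars P θ

  module _ {ℓ ℓ′} {P : ℕ → Set ℓ} {Q : ℕ → Set ℓ′} where

    allVars-map : (∀ {p} → P p → Q p) → ∀ θ → AllVars P θ → AllVars Q θ
    allVars-map f (var p) h       = f h
    allVars-map f ⊥'      h       = tt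
    allVars-map f (θ ⇒ η) (h , g) = allVars-map f θ h , allVars-map f η g
    allVars-map f (◇ _ θ) h       = allVars-map f θ h

  allVars-universal : ∀ {ℓ} {P : ℕ → Set ℓ} → (∀ p → P p) → ∀ θ → AllVars P θ
  allVars-universal u (var p) = u p
  allVars-universal u ⊥'      = tt
  allVars-universal u (θ ⇒ η) = allVars-universal u θ , allVars-universal u η
  allVars-universal u (◇ _ θ) = allVars-universal u θ

  varBound : Formula k → ℕ
  varBound (var p) = suc p
  varBound ⊥'      = 0
  varBound (θ ⇒ η) = varBound θ ⊔ varBound η
  varBound (◇ _ θ) = varBound θ

  allVars-<-varBound : ∀ θ → AllVars (_< varBound θ) θ
  allVars-<-varBound (var p) = n<1+n p
  allVars-<-varBound ⊥'      = tt
  allVars-<-varBound (θ ⇒ η) =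
    allVars-map (λ p< → <-≤-trans p< (m≤m⊔n (varBound θ) _)) θ (allVars-<-varBound θ) ,
    allVars-map (λ p< → <-≤-trans p< (m≤n⊔m _ (varBound η))) η (allVars-<-varBound η)
  allVars-<-varBound (◇ _ θ) = allVars-<-varBound θ

  module BooleanClosure {ℓ} (Q : Formula k → Set ℓ)
         (Q-⊥ : Q ⊥') (Q-⇒ : ∀ {θ η} → Q θ → Q η → Q (θ ⇒ η)) where

    ¬-closed : ∀ {θ} → Q θ → Q (¬' θ)
    ¬-closed q = Q-⇒ q Q-⊥

    conj-closed : ∀ θs s → All Q θs → Q (conj θs s)
    conj-closed []       []      _          = ¬-closed Q-⊥
    conj-closed []       (_ ∷ _) _          = Q-⊥
    conj-closed (_ ∷ _)  []      _          = Q-⊥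
    conj-closed (θ ∷ θs) (b ∷ s) (qθ ∷ qθs) =
      ¬-closed (Q-⇒ (literal-closed b) (¬-closed (conj-closed θs s qθs)))
      where
      literal-closed : ∀ b → Q (literal b θ)
      literal-closed true  = qθ
      literal-closed false = ¬-closed qθ

    disj-closed : ∀ θs → All Q θs → Q (disj θs)
    disj-closed []       []         = Q-⊥
    disj-closed (θ ∷ θs) (qθ ∷ qθs) = Q-⇒ (¬-closed qθ) (disj-closed θs qθs)

  diamonds : List (Formula k) → List (Formula k)
  diamonds θs = cartesianProductWith (λ i s → ◇ i (conj θs s)) (allFin k) (signs (length θs))

  ∈-diamonds⁻ : ∀ {θ} θs → θ ∈ diamonds θs →
                Σ (Fin k) λ i → Σ (List Bool) λ s → θ ≡ ◇ i (conj θs s)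
  ∈-diamonds⁻ θs θ∈
    with i , s , _ , _ , θ≡ ← ∈-cartesianProductWith⁻ _ (allFin k) (signs (length θs)) θ∈ =
    i , s , θ≡

  -- Every formula of depth ≤ d in the variables ps is a Boolean combination of
  -- members of basis ps d.
  basis : List ℕ → ℕ → List (Formula k)
  basis ps zero    = map var ps
  basis ps (suc d) = basis ps d ++ diamonds (basis ps d)

  record Bounded (ps : List ℕ) (d : ℕ) (θ : Formula k) : Set where
    constructor bounded
    field
      depth≤ : depth θ ≤ d
      vars∈  : AllVars (_∈ ps) θ

  ⇒-bounded : ∀ {ps d θ η} → Bounded ps d θ → Bounded ps d η → Bounded ps d (θ ⇒ η)
  ⇒-bounded (bounded dθ vθ) (bounded dη vη) = bounded (⊔-lub dθ dη) (vθ , vη)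

  conj-bounded : ∀ {ps d} θs s → All (Bounded ps d) θs → Bounded ps d (conj θs s)
  conj-bounded = BooleanClosure.conj-closed _ (bounded z≤n tt) ⇒-bounded

  disj-bounded : ∀ {ps d} θs → All (Bounded ps d) θs → Bounded ps d (disj θs)
  disj-bounded = BooleanClosure.disj-closed _ (bounded z≤n tt) ⇒-bounded

  basis-bounded : ∀ ps d {θ} → θ ∈ basis ps d → Bounded ps d θ
  basis-bounded ps zero θ∈ with _ , p∈ , refl ← ∈-map⁻ var θ∈ = bounded z≤n p∈
  basis-bounded ps (suc d) θ∈ with ∈-++⁻ (basis ps d) θ∈
  ... | inj₁ θ∈′ = let bounded dθ vθ = basis-bounded ps d θ∈′ in bounded (m≤n⇒m≤1+n dθ) vθ
  ... | inj₂ θ∈′ with _ , s , refl ← ∈-diamonds⁻ (basis ps d) θ∈′ =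
    let bounded dθ vθ = conj-bounded (basis ps d) s (All.tabulate (basis-bounded ps d))
    in bounded (s≤s dθ) vθ

record Pointed (k : ℕ) : Set₁ where
  constructor ⟨_,_,_⟩
  field
    frame : Frame k
    val   : Valuation frame
    point : X frame
open Pointed

_⊨_ : ∀ {k} → Pointed k → Formula k → Set
M ⊨ θ = Sat (frame M) (val M) (point M) θ

Agree : ∀ {k} → Pointed k → Pointed k → List (Formula k) → Set
Agree M N θs = All (λ θ → M ⊨ θ ⇔ N ⊨ θ) θs

Over : ∀ {k} → (Frame k → Set₁) → Pointed k → Set₁
Over 𝓕 ⟨ F , v , _ ⟩ = 𝓕 F × (∀ p → A F (v p))

agree-refl : ∀ {k} (M : Pointed k) θs → Agree M M θs
agree-refl M = All.universal (λ _ → ⇔.refl)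

module _ {k : ℕ} {I : Set} (F : I → Frame k) (v : ∀ i → Valuation (F i)) where

  sumValuation : Valuation (sumFrame F)
  sumValuation p (i , x) = v i p x

  sat-sum : ∀ θ i x → Sat (sumFrame F) sumValuation (i , x) θ ⇔ Sat (F i) (v i) x θ
  sat-sum (var p) i x = ⇔.refl
  sat-sum ⊥'      i x = ⇔.refl
  sat-sum (θ ⇒ η) i x = mk⇔ (λ h → to (sat-sum η i x) ∘ h ∘ from (sat-sum θ i x))
                            (λ h → from (sat-sum η i x) ∘ h ∘ to (sat-sum θ i x))
  sat-sum (◇ j θ) i x = mk⇔ (λ { (_ , inj {y = y} r , sy) → y , r , to (sat-sum θ i y) sy })
                            (λ { (y , r , sy) → (i , y) , inj r , from (sat-sum θ i y) sy })

Pre-⇔-◇ : ∀ {k} {F : Frame k} {v : Valuation F} {W : Subset (X F)} i θ →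
          (∀ y → W y ⇔ Sat F v y θ) → ∀ x → Pre F i W x ⇔ Sat F v x (◇ i θ)
Pre-⇔-◇ i θ W⇔θ x = mk⇔ (λ (y , r , wy) → y , r , to (W⇔θ y) wy)
                      (λ (y , r , sy) → y , r , from (W⇔θ y) sy)

listValuation : {Y : Set} → List (Subset Y) → ℕ → Subset Y
listValuation []       p       = λ _ → ⊥
listValuation (V ∷ Vs) zero    = V
listValuation (V ∷ Vs) (suc p) = listValuation Vs p

applyUpTo-listValuation : {Y : Set} (Vs : List (Subset Y)) →
                          applyUpTo (listValuation Vs) (length Vs) ≡ Vs
applyUpTo-listValuation []       = refl
applyUpTo-listValuation (V ∷ Vs) = cong (V ∷_) (applyUpTo-listValuation Vs)

listValuation-beyond : {Y : Set} (Vs : List (Subset Y)) {p : ℕ} {y : Y} →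
                       length Vs ≤ p → ¬ listValuation Vs p y
listValuation-beyond []       _         ()
listValuation-beyond (V ∷ Vs) (s≤s len≤p) = listValuation-beyond Vs len≤p

∅-admissible : ∀ {k} {F : Frame k} → IsGeneral F → A F (λ _ → ⊥)
∅-admissible gen = resp (compl top) (λ _ → mk⇔ (λ ¬⊤ → ¬⊤ _) ⊥-elim)
  where open IsGeneral gen

listValuation-admissible : ∀ {k} {F : Frame k} → IsGeneral F →
                           ∀ {Vs} → All (A F) Vs → ∀ p → A F (listValuation Vs p)
listValuation-admissible gen []         p       = ∅-admissible gen
listValuation-admissible gen (aV ∷ aVs) zero    = aV
listValuation-admissible gen (aV ∷ aVs) (suc p) = listValuation-admissible gen aVs p

module _ (em₀ : ExcludedMiddle 0ℓ) (em₁ : ExcludedMiddle (lsuc 0ℓ)) where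

  module _ {k : ℕ} {M : Pointed k} where

    sat-∧ : ∀ θ η → M ⊨ (θ ∧' η) ⇔ (M ⊨ θ × M ⊨ η)
    sat-∧ θ η = mk⇔ (λ h → em⇒dne em₀ (λ ¬θ → h (λ sθ _ → ¬θ sθ)) ,
                           em⇒dne em₀ (λ ¬η → h (λ _ sη → ¬η sη)))
                    (λ (sθ , sη) f → f sθ sη)

    sat-⟺ : ∀ θ η → M ⊨ (θ ⟺ η) ⇔ (M ⊨ θ ⇔ M ⊨ η)
    sat-⟺ θ η = mk⇔ (λ h → let θ⇒η , η⇒θ = to (sat-∧ (θ ⇒ η) (η ⇒ θ)) h in mk⇔ θ⇒η η⇒θ)
                    (λ e → from (sat-∧ (θ ⇒ η) (η ⇒ θ)) (to e , from e))

    sat-disj : ∀ θs → M ⊨ disj θs ⇔ Any (M ⊨_) θs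
    sat-disj θs = mk⇔ (⇒any θs) (any⇒ θs)
      where
      ⇒any : ∀ θs → M ⊨ disj θs → Any (M ⊨_) θs
      ⇒any (θ ∷ θs) h with em₀ {M ⊨ θ}
      ... | yes sθ = here sθ
      ... | no ¬sθ = there (⇒any θs (h ¬sθ))
      any⇒ : ∀ θs → Any (M ⊨_) θs → M ⊨ disj θs
      any⇒ (θ ∷ θs) (here sθ)  ¬sθ = ⊥-elim (¬sθ sθ)
      any⇒ (θ ∷ θs) (there sθs) _  = any⇒ θs sθs

  module _ {k : ℕ} where

    truthValues : Pointed k → List (Formula k) → List Bool
    truthValues M = map (λ θ → does (em₀ {M ⊨ θ}))

    typeOf : Pointed k → List (Formula k) → Formula k
    typeOf M θs = conj θs (truthValues M θs)

    ◇-typeOf∈diamonds : ∀ M i θs → ◇ i (typeOf M θs) ∈ diamonds θs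
    ◇-typeOf∈diamonds M i θs =
      ∈-cartesianProductWith⁺ (λ i s → ◇ i (conj θs s)) (∈-allFin i) (∈-signs _ θs)

    conj⇒agree : ∀ {M N : Pointed k} θs s → M ⊨ conj θs s → N ⊨ conj θs s → Agree M N θs
    conj⇒agree []       []      _  _  = []
    conj⇒agree (θ ∷ θs) (b ∷ s) sM sN =
      let lM , cM = to (sat-∧ (literal b θ) (conj θs s)) sM
          lN , cN = to (sat-∧ (literal b θ) (conj θs s)) sN
      in literal-agree b lM lN ∷ conj⇒agree θs s cM cN
      where
      literal-agree : ∀ {M N : Pointed k} b → M ⊨ literal b θ → N ⊨ literal b θ → M ⊨ θ ⇔ N ⊨ θ
      literal-agree true  sM  sN  = mk⇔ (λ _ → sN) (λ _ → sM)
      literal-agree false ¬sM ¬sN = mk⇔ (⊥-elim ∘ ¬sM) (⊥-elim ∘ ¬sN)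

    agree⇒typeOf : ∀ {M N : Pointed k} θs → Agree M N θs → N ⊨ typeOf M θs
    agree⇒typeOf []       []          = λ ()
    agree⇒typeOf {M} {N} (θ ∷ θs) (e ∷ es) =
      from (sat-∧ (literal (does (em₀ {M ⊨ θ})) θ) (typeOf M θs))
           (literal-does (em₀ {M ⊨ θ}) , agree⇒typeOf θs es)
      where
      literal-does : (d : Dec (M ⊨ θ)) → N ⊨ literal (does d) θ
      literal-does (yes sM) = to e sM
      literal-does (no ¬sM) = ¬sM ∘ from e

    sat-typeOf-self : ∀ M θs → M ⊨ typeOf M θs
    sat-typeOf-self M θs = agree⇒typeOf θs (agree-refl M θs)

    sat-typeOf : ∀ M N θs → N ⊨ typeOf M θs ⇔ Agree M N θs
    sat-typeOf M N θs =
      mk⇔ (conj⇒agree θs _ (sat-typeOf-self M θs)) (agree⇒typeOf θs)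

  module Layers {k : ℕ} (F : Frame k) (𝒱 : List (Subset (X F))) where

    sim-refl : ∀ d a → sim F 𝒱 d a a
    sim-refl zero    a = lift (All.universal (λ _ → ⇔.refl) 𝒱)
    sim-refl (suc d) a = (λ _ _ → ⇔.refl) , (λ _ _ _ → ⇔.refl)

    sim-sym : ∀ {d a b} → sim F 𝒱 d a b → sim F 𝒱 d b a
    sim-sym {zero}  (lift s) = lift (All.map ⇔.sym s)
    sim-sym {suc d} (s , t)  = (λ W c → ⇔.sym (s W c)) , (λ i W c → ⇔.sym (t i W c))

    sim-trans : ∀ {d a b c} → sim F 𝒱 d a b → sim F 𝒱 d b c → sim F 𝒱 d a c
    sim-trans {zero}  (lift s) (lift s′) = lift (All.zipWith (λ (e , e′) → ⇔.trans e e′) (s , s′))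
    sim-trans {suc d} (s , t)  (s′ , t′) =
      (λ W c → ⇔.trans (s W c) (s′ W c)) , (λ i W c → ⇔.trans (t i W c) (t′ i W c))

    IsClass-resp : ∀ {d W a b} → IsClass (sim F 𝒱 d) W → sim F 𝒱 d a b → W a ⇔ W b
    IsClass-resp {a = a} {b} (c , hc) s =
      mk⇔ (λ wa → from (hc b) (sim-trans (to (hc a) wa) s))
          (λ wb → from (hc a) (sim-trans (to (hc b) wb) (sim-sym s)))

    -- Subsets are Set-valued while sim is Set₁-valued: the class of a is
    -- squashed into Set by deciding membership classically.
    classOf : ℕ → X F → Subset (X F)
    classOf d a b = True (em₁ {sim F 𝒱 d a b})

    classOf-isClass : ∀ d a → IsClass (sim F 𝒱 d) (classOf d a)
    classOf-isClass d a = a , λ b → mk⇔ toWitness fromWitness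

    sim-suc⇒sim : ∀ {d a b} → sim F 𝒱 (suc d) a b → sim F 𝒱 d a b
    sim-suc⇒sim {d} {a} (s , _) =
      toWitness (to (s (classOf d a) (classOf-isClass d a)) (fromWitness (sim-refl d a)))

    sim-mono : ∀ {e d a b} → e ≤ d → sim F 𝒱 d a b → sim F 𝒱 e a b
    sim-mono = go ∘ ≤⇒≤′
      where
      go : ∀ {e d a b} → e ≤′ d → sim F 𝒱 d a b → sim F 𝒱 e a b
      go ≤′-refl        s = s
      go (≤′-step e≤′d) s = go e≤′d (sim-suc⇒sim s)

    MdSet≤⇔sim-refines : ∀ n → MdSet≤ F 𝒱 n ⇔ (∀ d {a b} → sim F 𝒱 n a b → sim F 𝒱 d a b)
    MdSet≤⇔sim-refines n = mk⇔ refines layered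
      where
      refines : MdSet≤ F 𝒱 n → ∀ d {a b} → sim F 𝒱 n a b → sim F 𝒱 d a b
      refines md d {a} {b} s with md d (classOf d a) (classOf-isClass d a)
      ... | e , e≤n , (c , hc) =
        toWitness (from (hc b) (sim-trans (to (hc a) (fromWitness (sim-refl d a))) (sim-mono e≤n s)))
      layered : (∀ d {a b} → sim F 𝒱 n a b → sim F 𝒱 d a b) → MdSet≤ F 𝒱 n
      layered ref d V (a , hV) with ≤-total d n
      ... | inj₁ d≤n = d , d≤n , (a , hV)
      ... | inj₂ n≤d = n , ≤-refl , (a , λ b → ⇔.trans (hV b) (mk⇔ (sim-mono n≤d) (ref d)))

    Invariant : Subset (X F) → Set₁
    Invariant V = ∀ a b → sim F 𝒱 0 a b → V a → V b

    ∈⇒Invariant : ∀ {V} → V ∈ 𝒱 → Invariant V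
    ∈⇒Invariant V∈ _ _ (lift s) = to (All.lookup s V∈)

    sat-invariant : (v : Valuation F) → ∀ d θ → depth θ ≤ d → AllVars (Invariant ∘ v) θ →
                    ∀ {a b} → sim F 𝒱 d a b → Sat F v a θ → Sat F v b θ
    sat-invariant v d (var p) _  inv s sa = inv _ _ (sim-mono z≤n s) sa
    sat-invariant v d (θ ⇒ η) dθη (iθ , iη) s sa sb =
      sat-invariant v d η (m⊔n≤o⇒n≤o _ _ dθη) iη s
        (sa (sat-invariant v d θ (m⊔n≤o⇒m≤o _ _ dθη) iθ (sim-sym s) sb))
    sat-invariant v (suc d) (◇ i θ) (s≤s dθ) iθ (_ , t) (y , r , sy)
      with z , r′ , z∈ ← to (t i (classOf d y) (classOf-isClass d y))
                            (y , r , fromWitness (sim-refl d y)) =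
      z , r′ , sat-invariant v d θ dθ iθ (toWitness z∈) sy

  module Characterisation {k : ℕ} (F : Frame k) (v : Valuation F) (ps : List ℕ) where
    open Layers F (map v ps)

    at : X F → Pointed k
    at x = ⟨ F , v , x ⟩

    sim⇒agree : ∀ d {a b} → sim F (map v ps) d a b → Agree (at a) (at b) (basis ps d)
    sim⇒agree d s = All.tabulate λ {θ} θ∈ →
      let bounded dθ vθ = basis-bounded ps d θ∈
          inv     = allVars-map (λ p∈ → ∈⇒Invariant (∈-map⁺ v p∈)) θ vθ
      in mk⇔ (sat-invariant v d θ dθ inv s) (sat-invariant v d θ dθ inv (sim-sym s))

    agree⇒sim : ∀ d {a b} → Agree (at a) (at b) (basis ps d) → sim F (map v ps) d a b
    sat-typeOf-basis : ∀ d {a b} → at b ⊨ typeOf (at a) (basis ps d) ⇔ sim F (map v ps) d a b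

    agree⇒sim zero    ag = lift (map⁺ (map⁻ ag))
    agree⇒sim (suc d) {a} {b} ag =
      (λ W W-class → IsClass-resp W-class (agree⇒sim d (++⁻ˡ (basis ps d) ag))) , Pre-agree
      where
      Pre-agree : ∀ i W → IsClass (sim F (map v ps) d) W → Pre F i W a ⇔ Pre F i W b
      Pre-agree i W (c , hc) =
        ⇔.trans (Pre-⇔-◇ i (typeOf (at c) (basis ps d)) W⇔typeOf a)
          (⇔.trans (All.lookup (++⁻ʳ (basis ps d) ag) (◇-typeOf∈diamonds (at c) i (basis ps d)))
            (⇔.sym (Pre-⇔-◇ i (typeOf (at c) (basis ps d)) W⇔typeOf b)))
        where
        W⇔typeOf : ∀ y → W y ⇔ at y ⊨ typeOf (at c) (basis ps d)
        W⇔typeOf y = ⇔.trans (hc y) (⇔.sym (sat-typeOf-basis d))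

    sat-typeOf-basis d {a} {b} =
      ⇔.trans (sat-typeOf (at a) (at b) (basis ps d)) (mk⇔ (agree⇒sim d) (sim⇒agree d))

  module _ {k : ℕ} (𝓕 : Frame k → Set₁) (n : ℕ) where

    MdLogic≤⇒sim-refines : MdLogic≤ (Log 𝓕) n →
                           ∀ {F} → 𝓕 F → (v : Valuation F) → (∀ p → A F (v p)) →
                           ∀ ps → (∀ p → Layers.Invariant F (map v ps) (v p)) →
                           ∀ d {a b} → sim F (map v ps) n a b → sim F (map v ps) d a b
    MdLogic≤⇒sim-refines md {F} F∈𝓕 v adm ps inv d {a} {b} s =
      let ψ , dψ , φ⟺ψ = md φ
          φ⇔ψ : ∀ x → at x ⊨ φ ⇔ at x ⊨ ψ
          φ⇔ψ x = to (sat-⟺ {M = at x} φ ψ) (φ⟺ψ F F∈𝓕 v adm x)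
      in to (sat-typeOf-basis d) (from (φ⇔ψ b) (sat-invariant v n ψ dψ (allVars-universal inv ψ) s
           (to (φ⇔ψ a) (sat-typeOf-self (at a) (basis ps d)))))
      where
      open Layers F (map v ps)
      open Characterisation F v ps
      φ : Formula k
      φ = typeOf (at a) (basis ps d)

    MdLogic≤⇒MdClass≤ : (∀ F → 𝓕 F → IsGeneral F) → MdLogic≤ (Log 𝓕) n → MdClass≤ 𝓕 n
    MdLogic≤⇒MdClass≤ general md F F∈𝓕 𝒱 adm =
      subst (λ 𝒲 → MdSet≤ F 𝒲 n) 𝒱-listed
        (from (MdSet≤⇔sim-refines n) (MdLogic≤⇒sim-refines md F∈𝓕 v admissible ps invariant))
      where
      v : Valuation F
      v = listValuation 𝒱
      ps : List ℕ
      ps = upTo (length 𝒱)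
      open Layers F (map v ps)
      𝒱-listed : map v ps ≡ 𝒱
      𝒱-listed = trans (map-upTo v (length 𝒱)) (applyUpTo-listValuation 𝒱)
      admissible : ∀ p → A F (v p)
      admissible = listValuation-admissible (general F F∈𝓕) adm
      invariant : ∀ p → Invariant (v p)
      invariant p with p <? length 𝒱
      ... | yes p< = ∈⇒Invariant (∈-map⁺ v (∈-upTo⁺ p<))
      ... | no  p≮ = λ _ _ _ vpa → ⊥-elim (listValuation-beyond 𝒱 (≮⇒≥ p≮) vpa)

    module _ (closed : ClosedUnderCountableSums 𝓕) (md : MdClass≤ 𝓕 n) where

      agree-basis⇒agree : ∀ m {M N} → Over 𝓕 M → Over 𝓕 N → Agree M N (basis (upTo m) n) →
                          ∀ φ → AllVars (_< m) φ → M ⊨ φ → N ⊨ φ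
      agree-basis⇒agree m {M} {N} M∈𝓕 N∈𝓕 ag φ vφ Mφ =
        to (sat-sum frames vals φ (suc zero) _)
          (sat-invariant vSum (depth φ) φ ≤-refl φ-invariant sim-φ
            (from (sat-sum frames vals φ zero _) Mφ))
        where
        models : Fin 2 → Pointed k
        models zero       = M
        models (suc zero) = N
        models-over : ∀ i → Over 𝓕 (models i)
        models-over zero       = M∈𝓕
        models-over (suc zero) = N∈𝓕
        frames : Fin 2 → Frame k
        frames = frame ∘ models
        vals : ∀ i → Valuation (frames i)
        vals i = val (models i)
        Sum : Frame k
        Sum = sumFrame frames
        vSum : Valuation Sum
        vSum = sumValuation frames vals
        Sum∈𝓕 : 𝓕 Sum
        Sum∈𝓕 = closed (Fin 2) (toℕ , toℕ-injective) frames (proj₁ ∘ models-over)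
        𝒱 : List (Subset (X Sum))
        𝒱 = map vSum (upTo m)
        𝒱-admissible : All (A Sum) 𝒱
        𝒱-admissible = map⁺ (All.universal (λ p i → proj₂ (models-over i) p) (upTo m))
        open Layers Sum 𝒱
        open Characterisation Sum vSum (upTo m)
        agreeSum : Agree (at (zero , point M)) (at (suc zero , point N)) (basis (upTo m) n)
        agreeSum = All.map (λ {θ} e → ⇔.trans (sat-sum frames vals θ zero _)
                                      (⇔.trans e (⇔.sym (sat-sum frames vals θ (suc zero) _)))) ag
        sim-φ : sim Sum 𝒱 (depth φ) (zero , point M) (suc zero , point N)
        sim-φ = to (MdSet≤⇔sim-refines n) (md Sum Sum∈𝓕 𝒱 𝒱-admissible) (depth φ)
                   (agree⇒sim n agreeSum)
        φ-invariant : AllVars (Invariant ∘ vSum) φ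
        φ-invariant = allVars-map (λ p< → ∈⇒Invariant (∈-map⁺ vSum (∈-upTo⁺ p<))) φ vφ

      MdClass≤⇒MdLogic≤ : MdLogic≤ (Log 𝓕) n
      MdClass≤⇒MdLogic≤ φ =
        χ , χ-depth , λ F F∈𝓕 v adm x → from (sat-⟺ φ χ) (φ⇔χ ⟨ F , v , x ⟩ (F∈𝓕 , adm))
        where
        m : ℕ
        m = varBound φ
        Ln : List (Formula k)
        Ln = basis (upTo m) n
        Realises : List Bool → Set₁
        Realises s = Σ (Pointed k) λ N → Over 𝓕 N × N ⊨ conj Ln s × N ⊨ φ
        realises? : ∀ s → Dec (Realises s)
        realises? s = em₁
        realised : List (List Bool)
        realised = filter realises? (signs (length Ln))
        χ : Formula k
        χ = disj (map (conj Ln) realised)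

        χ-depth : depth χ ≤ n
        χ-depth = Bounded.depth≤ (disj-bounded (map (conj Ln) realised) (map⁺ (All.universal
          (λ s → conj-bounded Ln s (All.tabulate (basis-bounded (upTo m) n))) realised)))

        χ⇒φ : ∀ {M} → Over 𝓕 M → ∀ {θ} → θ ∈ map (conj Ln) realised → M ⊨ θ → M ⊨ φ
        χ⇒φ M∈𝓕 θ∈ Mθ
          with s , s∈ , refl ← ∈-map⁻ (conj Ln) θ∈
          with _ , (N , N∈𝓕 , Ns , Nφ) ← ∈-filter⁻ realises? {xs = signs (length Ln)} s∈ =
          agree-basis⇒agree m N∈𝓕 M∈𝓕 (conj⇒agree Ln s Ns Mθ) φ (allVars-<-varBound φ) Nφ

        φ⇔χ : ∀ M → Over 𝓕 M → M ⊨ φ ⇔ M ⊨ χ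
        φ⇔χ M M∈𝓕 = mk⇔
          (λ Mφ → from (sat-disj _)
            (lose (∈-map⁺ (conj Ln) (∈-filter⁺ realises? (∈-signs _ Ln)
                     (M , M∈𝓕 , sat-typeOf-self M Ln , Mφ)))
                  (sat-typeOf-self M Ln)))
          (λ Mχ → let _ , θ∈ , Mθ = find (to (sat-disj _) Mχ) in χ⇒φ M∈𝓕 θ∈ Mθ)

theorem6p13 : ((ℓ : Level) → ExcludedMiddle ℓ) →
    (k : ℕ) (𝓕 : Frame k → Set₁) →
    (∀ F → 𝓕 F → IsGeneral F) →
    ClosedUnderCountableSums 𝓕 →
    (n : ℕ) → MdClass≤ 𝓕 n ⇔ MdLogic≤ (Log 𝓕) n
theorem6p13 em k 𝓕 general closed n =
  mk⇔ (MdClass≤⇒MdLogic≤ (em 0ℓ) (em (lsuc 0ℓ)) 𝓕 n closed)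
      (MdLogic≤⇒MdClass≤ (em 0ℓ) (em (lsuc 0ℓ)) 𝓕 n general)
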